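{- Let $k\ge 3$ and $n\in\mathbb{Z}_{\ge 0}$, let $T_n=\frac12 n(n+1)$, and for each $m\in\mathbb{Z}_{\ge 0}$ let $$P_m=\Bigl\{(T_m,m_1,\dots,m_{k-1})\in\mathbb{Z}_{\ge0}^k : \sum_{i=1}^{k-1}m_i=(k-1)T_m+m,\ T_m\le m_1\le\dots\le m_{k-1}\Bigr\}.$$ Then every integer $t$ with $T_n\le t<T_{n+1}$ appears as a component of some $k$-tuple in $P_n$, and $t$ appears as a component of no $k$-tuple in $P_m$ for any $m\ne n$.
   Context: $T_n=\frac12 n(n+1)$ denotes the $n$-th triangular number; a component of a $k$-tuple is any of its entries. -}

module Defs where

open import Data.Nat using (ℕ; suc; _+_; _*_; _≤_; _/_)
open import Data.Fin as Fin using (Fin)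
open import Data.Vec using (Vec; []; _∷_; lookup; sum)
open import Data.Vec.Relation.Unary.All using (All)
open import Data.Product using (_×_)
open import Data.Empty using (⊥)
open import Relation.Binary.PropositionalEquality using (_≡_)

T : ℕ → ℕ
T n = (n * suc n) / 2

InP : (k : ℕ) → ℕ → Vec ℕ k → Set
InP _ m [] = ⊥
InP (suc j) m (x ∷ rest) =
  x ≡ T m
  × sum rest ≡ j * T m + m
  × All (T m ≤_) rest
  × (∀ (i i′ : Fin j) → i Fin.≤ i′ → lookup rest i ≤ lookup rest i′)

{-# OPTIONS --safe #-}
-- Every component of a tuple in P_m lies in [T_m, T_m + m]: the first one is T_m, and the
-- others are ≥ T_m and sum to (k-1) T_m + m, so none exceeds T_m by more than m. These
-- intervals are exactly the blocks [T_m, T_{m+1}), which partition ℕ. Conversely, if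
-- t = T_n + d with d ≤ n, pad T_n + d and T_n + (n - d), in increasing order, with k - 2
-- copies of T_n.
module Submission where

open import Defs
open import Data.Nat using (ℕ; zero; suc; _+_; _*_; _∸_; _≤_; _<_; _≤?_; s≤s; s≤s⁻¹; _/_)
open import Data.Nat.Properties
open import Algebra.Properties.CommutativeSemigroup +-commutativeSemigroup
  using (x∙yz≈y∙xz; xy∙z≈xz∙y)
open import Data.Nat.DivMod using (+-distrib-/-∣ʳ; m*n/n≡m; /-monoˡ-≤)
open import Data.Nat.Divisibility using (divides)
open import Data.Nat.Tactic.RingSolver using (solve-∀)
open import Data.Fin as Fin using (Fin)
open import Data.Vec using (Vec; []; _∷_; lookup; sum)
open import Data.Vec.Relation.Unary.All as All using (All; []; _∷_)
open import Data.Vec.Relation.Unary.All.Properties using (lookup⁺)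
open import Data.Vec.Relation.Unary.Any using (here; there)
open import Data.Vec.Membership.Propositional using (_∈_)
open import Data.Product using (_×_; ∃; _,_)
open import Relation.Nullary using (¬_; yes; no)
open import Relation.Binary.PropositionalEquality

T-suc : ∀ m → T (suc m) ≡ T m + suc m
T-suc m = begin
  (suc m * suc (suc m)) / 2        ≡⟨ cong (_/ 2) (numerator m) ⟩
  (m * suc m + suc m * 2) / 2      ≡⟨ +-distrib-/-∣ʳ (m * suc m) (divides (suc m) refl) ⟩
  T m + suc m * 2 / 2              ≡⟨ cong (T m +_) (m*n/n≡m (suc m) 2) ⟩
  T m + suc m                      ∎
  where
  open ≡-Reasoning
  numerator : ∀ m → suc m * suc (suc m) ≡ m * suc m + suc m * 2
  numerator = solve-∀

T-mono-≤ : ∀ {m n} → m ≤ n → T m ≤ T n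
T-mono-≤ m≤n = /-monoˡ-≤ 2 (*-mono-≤ m≤n (s≤s m≤n))

<T-suc⇒≤T+ : ∀ m {t} → t < T (suc m) → t ≤ T m + m
<T-suc⇒≤T+ m {t} t<T = s≤s⁻¹ (subst (t <_) (trans (T-suc m) (+-suc (T m) m)) t<T)

≤T+⇒<T-suc : ∀ m {t} → t ≤ T m + m → t < T (suc m)
≤T+⇒<T-suc m {t} t≤ = subst (t <_) (sym (trans (T-suc m) (+-suc (T m) m))) (s≤s t≤)

record Block (m t : ℕ) : Set where
  constructor block
  field
    lower : T m ≤ t
    upper : t < T (suc m)

T≤-<T-suc⇒≤ : ∀ {m n t} → T m ≤ t → t < T (suc n) → m ≤ n
T≤-<T-suc⇒≤ Tm≤t t<Tn+1 = ≮⇒≥ λ n<m → <-irrefl refl (<-≤-trans t<Tn+1 (≤-trans (T-mono-≤ n<m) Tm≤t))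

Block-unique : ∀ {m n t} → Block m t → Block n t → m ≡ n
Block-unique (block lo₁ hi₁) (block lo₂ hi₂) = ≤-antisym (T≤-<T-suc⇒≤ lo₁ hi₂) (T≤-<T-suc⇒≤ lo₂ hi₁)

All-≤⇒*≤sum : ∀ {j c} {v : Vec ℕ j} → All (c ≤_) v → j * c ≤ sum v
All-≤⇒*≤sum []         = ≤-refl
All-≤⇒*≤sum (c≤y ∷ c≤) = +-mono-≤ c≤y (All-≤⇒*≤sum c≤)

∈⇒+*≤sum : ∀ {j c x} {v : Vec ℕ (suc j)} → All (c ≤_) v → x ∈ v → x + j * c ≤ sum v
∈⇒+*≤sum {x = x} (_ ∷ c≤) (here refl) = +-monoʳ-≤ x (All-≤⇒*≤sum c≤)
∈⇒+*≤sum {suc j} {c} {x} {y ∷ ys} (c≤y ∷ c≤) (there x∈) = begin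
  x + (c + j * c)   ≡⟨ x∙yz≈y∙xz x c (j * c) ⟩
  c + (x + j * c)   ≤⟨ +-mono-≤ c≤y (∈⇒+*≤sum c≤ x∈) ⟩
  y + sum ys        ∎
  where open ≤-Reasoning

InP⇒Block : ∀ {k m t} {v : Vec ℕ k} → InP k m v → t ∈ v → Block m t
InP⇒Block {m = m} (refl , _) (here refl) = block ≤-refl (≤T+⇒<T-suc m (m≤m+n (T m) m))
InP⇒Block {suc (suc j)} {m} {t} (_ , sum≡ , Tm≤ , _) (there t∈) =
  block (All.lookup Tm≤ t∈) (≤T+⇒<T-suc m (+-cancelʳ-≤ (j * T m) t (T m + m) t+≤))
  where
  t+≤ : t + j * T m ≤ T m + m + j * T m
  t+≤ = ≤-trans (∈⇒+*≤sum Tm≤ t∈) (≤-reflexive (trans sum≡ (xy∙z≈xz∙y (T m) (j * T m) m)))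

Sorted : ∀ {j} → Vec ℕ j → Set
Sorted {j} v = ∀ (i i′ : Fin j) → i Fin.≤ i′ → lookup v i ≤ lookup v i′

[]-sorted : Sorted []
[]-sorted ()

∷-sorted : ∀ {j x} {v : Vec ℕ j} → All (x ≤_) v → Sorted v → Sorted (x ∷ v)
∷-sorted x≤ v↑ Fin.zero    Fin.zero     _         = ≤-refl
∷-sorted x≤ v↑ Fin.zero    (Fin.suc i′) _         = lookup⁺ x≤ i′
∷-sorted x≤ v↑ (Fin.suc i) (Fin.suc i′) (s≤s i≤) = v↑ i i′ i≤

padded : (c j a b : ℕ) → Vec ℕ (suc (suc j))
padded c zero    a b = c + a ∷ c + b ∷ []
padded c (suc j) a b = c ∷ padded c j a b

sum-padded : ∀ c j a b → sum (padded c j a b) ≡ suc (suc j) * c + (a + b)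
sum-padded c zero    a b = pair-sum c a b
  where
  pair-sum : ∀ c a b → c + a + (c + b + 0) ≡ c + (c + 0 * c) + (a + b)
  pair-sum = solve-∀
sum-padded c (suc j) a b = trans (cong (c +_) (sum-padded c j a b)) (sym (+-assoc c _ _))

padded-≥ : ∀ c j a b → All (c ≤_) (padded c j a b)
padded-≥ c zero    a b = m≤m+n c a ∷ m≤m+n c b ∷ []
padded-≥ c (suc j) a b = ≤-refl ∷ padded-≥ c j a b

padded-sorted : ∀ c j {a b} → a ≤ b → Sorted (padded c j a b)
padded-sorted c zero    a≤b = ∷-sorted (+-monoʳ-≤ c a≤b ∷ []) (∷-sorted [] []-sorted)
padded-sorted c (suc j) a≤b = ∷-sorted (padded-≥ c j _ _) (padded-sorted c j a≤b)

+ˡ∈padded : ∀ c j a b → c + a ∈ padded c j a b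
+ˡ∈padded c zero    a b = here refl
+ˡ∈padded c (suc j) a b = there (+ˡ∈padded c j a b)

+ʳ∈padded : ∀ c j a b → c + b ∈ padded c j a b
+ʳ∈padded c zero    a b = there (here refl)
+ʳ∈padded c (suc j) a b = there (+ʳ∈padded c j a b)

padded-InP : ∀ j {n a b} → a ≤ b → a + b ≡ n → InP (3 + j) n (T n ∷ padded (T n) j a b)
padded-InP j {n} {a} {b} a≤b a+b≡n =
  refl ,
  trans (sum-padded (T n) j a b) (cong (suc (suc j) * T n +_) a+b≡n) ,
  padded-≥ (T n) j a b ,
  padded-sorted (T n) j a≤b

T+∈InP : ∀ j {n d} → d ≤ n → ∃ λ (v : Vec ℕ (3 + j)) → InP (3 + j) n v × T n + d ∈ v
T+∈InP j {n} {d} d≤n with d ≤? n ∸ d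
... | yes d≤e = _ , padded-InP j d≤e (m+[n∸m]≡n d≤n) , there (+ˡ∈padded (T n) j d (n ∸ d))
... | no  d≰e = _ , padded-InP j (<⇒≤ (≰⇒> d≰e)) (trans (+-comm (n ∸ d) d) (m+[n∸m]≡n d≤n)) ,
                there (+ʳ∈padded (T n) j (n ∸ d) d)

Block⇒∈InP : ∀ j {n t} → Block n t → ∃ λ (v : Vec ℕ (3 + j)) → InP (3 + j) n v × t ∈ v
Block⇒∈InP j {n} {t} (block Tn≤t t<) =
  subst (λ t → ∃ λ v → InP (3 + j) n v × t ∈ v) (m+[n∸m]≡n Tn≤t) (T+∈InP j d≤n)
  where
  d≤n : t ∸ T n ≤ n
  d≤n = +-cancelˡ-≤ (T n) _ n (subst (_≤ T n + n) (sym (m+[n∸m]≡n Tn≤t)) (<T-suc⇒≤T+ n t<))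

lemma2 : (k : ℕ) → 3 ≤ k → (n t : ℕ) → T n ≤ t → t < T (suc n) →
    (∃ λ (v : Vec ℕ k) → InP k n v × t ∈ v)
    × (∀ (m : ℕ) → m ≢ n → (v : Vec ℕ k) → InP k m v → ¬ (t ∈ v))
lemma2 (suc (suc (suc j))) (s≤s (s≤s (s≤s _))) n t Tn≤t t<Tn+1 =
  Block⇒∈InP j t∈Bₙ ,
  λ m m≢n v v∈Pm t∈v → m≢n (Block-unique (InP⇒Block v∈Pm t∈v) t∈Bₙ)
  where
  t∈Bₙ : Block n t
  t∈Bₙ = block Tn≤t t<Tn+1
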